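{- Let $n\ge1$ have binary expansion $n_k\cdots n_1n_0$ with $n_k=1$. Then the number $\delta(n)$ of $D$-nodes in the divide-and-conquer tree with $n$ leaves is $$\delta(n)=\sum_{i=0}^{\lfloor\log_2(n)\rfloor-1}\lambda_i(n),\qquad \lambda_i(n)=\begin{cases}n\bmod 2^i, & n_i=0,\\ 2^i-(n\bmod 2^i), & n_i=1,\end{cases}$$ and explicitly $\delta(n)=\sum_{i=0}^{\lfloor\log_2(n)\rfloor-1}\left(n_i2^i+(-1)^{n_i}(n\bmod 2^i)\right)$.
   Context: A full binary tree is a rooted tree in which every node has $0$ or $2$ children. An internal node is a $D$-node if its two children have different numbers of descendant leaves. A divide-and-conquer tree is a full binary tree in which, at every internal node, the numbers of leaves of the left and right subtrees differ by at most $1$; it is unique up to isomorphism for each number of leaves. -}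

module Defs where

open import Data.Nat using (ℕ; zero; suc; _+_; _∸_; _^_; _≤_; _<_)
import Data.Nat
import Data.Nat.Properties
import Relation.Nullary
open import Data.Nat.DivMod using (_/_; _%_)
open import Data.Nat.Logarithm using (⌊log₂_⌋)
open import Data.Integer as ℤ using (ℤ; +_)
open import Data.Product using (_×_)
open import Data.Unit using (⊤)
open import Relation.Nullary using (¬_)
open import Relation.Binary.PropositionalEquality using (_≡_)

data Tree : Set where
  leaf : Tree
  node : Tree → Tree → Tree

leaves : Tree → ℕ
leaves leaf = 1
leaves (node l r) = leaves l + leaves r

dnodes : Tree → ℕ
dnodes leaf = 0
dnodes (node l r) with leaves l Data.Nat.≟ leaves r
... | Relation.Nullary.yes _ = dnodes l + dnodes r
... | Relation.Nullary.no  _ = suc (dnodes l + dnodes r)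

DiffAtMostOne : ℕ → ℕ → Set
DiffAtMostOne a b = (a ≤ b + 1) × (b ≤ a + 1)

IsDC : Tree → Set
IsDC leaf = ⊤
IsDC (node l r) = DiffAtMostOne (leaves l) (leaves r) × IsDC l × IsDC r

modPow2 : ℕ → ℕ → ℕ
modPow2 n i = _%_ n (2 ^ i) {{Data.Nat.Properties.m^n≢0 2 i}}

divPow2 : ℕ → ℕ → ℕ
divPow2 n i = _/_ n (2 ^ i) {{Data.Nat.Properties.m^n≢0 2 i}}

bit : ℕ → ℕ → ℕ
bit n i = divPow2 n i % 2

lam : ℕ → ℕ → ℕ
lam n i with bit n i
... | 0 = modPow2 n i
... | _ = 2 ^ i ∸ (modPow2 n i)

sumBelow : ℕ → (ℕ → ℕ) → ℕ
sumBelow zero f = 0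
sumBelow (suc m) f = sumBelow m f + f m

sumBelowℤ : ℕ → (ℕ → ℤ) → ℤ
sumBelowℤ zero f = + 0
sumBelowℤ (suc m) f = sumBelowℤ m f ℤ.+ f m

negOnePow : ℕ → ℤ
negOnePow zero = + 1
negOnePow (suc k) = ℤ.- negOnePow k

explicitTerm : ℕ → ℕ → ℤ
explicitTerm n i = + (bit n i Data.Nat.* 2 ^ i) ℤ.+ negOnePow (bit n i) ℤ.* + (modPow2 n i)

{-# OPTIONS --safe #-}
module Submission where

-- The divide-and-conquer tree with n leaves splits into subtrees with ⌊n/2⌋ and ⌈n/2⌉
-- leaves, so δ(2a) = 2δ(a) and δ(2a+1) = 1 + δ(a) + δ(a+1). Write
-- Λ_m(n) = Σ_{i<m} λ_i(n). Halving n shifts its binary digits, which gives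
-- λ_{i+1}(2a) = 2λ_i(a) and λ_{i+1}(2a+1) = λ_i(a) + λ_i(a+1) (a carry out of the low
-- i digits of a flips digit i), and λ_0(n) = n mod 2; hence Λ satisfies the same
-- recurrences as δ. Both sides vanish on the trees with one or two leaves, so δ(n) = Λ_m(n)
-- whenever 2^m ≤ n ≤ 2^(m+1), in particular for m = ⌊log₂ n⌋.

open import Defs
open import Data.Nat using (ℕ; zero; suc; _+_; _*_; _∸_; _^_; _≤_; _<_; z≤n; s≤s; z<s; _≟_; ⌊_/2⌋; NonZero)
open import Data.Nat.Properties
open import Data.Nat.DivMod using (_%_; m%n<n; m≡m%n+[m/n]*n; [m+kn]%n≡m%n; m<n⇒m%n≡m; m<n⇒m/n≡0; m*n/n≡m; +-distrib-/-∣ʳ)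
open import Data.Nat.Divisibility using (n∣m*n)
open import Data.Nat.Logarithm using (⌊log₂_⌋; ⌊log₂⌋-mono-≤; ⌊log₂[2^n]⌋≡n; ⌊log₂⌊n/2⌋⌋≡⌊log₂n⌋∸1)
open import Data.Nat.Tactic.RingSolver using (solve-∀)
open import Algebra.Properties.CommutativeSemigroup +-commutativeSemigroup using (interchange)
open import Data.Integer as ℤ using (+_)
import Data.Integer.Properties as ℤ
open import Data.Product using (_×_; _,_; ∃-syntax)
open import Data.Sum using (_⊎_; inj₁; inj₂)
open import Relation.Nullary using (Dec; yes; no; contradiction)
open import Relation.Binary.PropositionalEquality
open ≡-Reasoning

2*n≡n+n : ∀ n → 2 * n ≡ n + n
2*n≡n+n n = cong (λ x → n + x) (+-identityʳ n)

m+m≤n+n⇒m≤n : ∀ {m n} → m + m ≤ n + n → m ≤ n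
m+m≤n+n⇒m≤n p = ≮⇒≥ λ n<m → <⇒≱ (+-mono-< n<m n<m) p

m+m≤n+1+n⇒m≤n : ∀ {m n} → m + m ≤ n + suc n → m ≤ n
m+m≤n+1+n⇒m≤n p = ≮⇒≥ λ n<m → <⇒≱ (+-mono-<-≤ n<m n<m) p

n+1+n≤m+m⇒n<m : ∀ {m n} → n + suc n ≤ m + m → n < m
n+1+n≤m+m⇒n<m p = ≮⇒≥ λ m<1+n → <⇒≱ (+-mono-≤-< (≤-pred m<1+n) m<1+n) p

module _ (i : ℕ) where
  private instance
    2^i≢0 : NonZero (2 ^ i)
    2^i≢0 = m^n≢0 2 i

  modPow2<2^ : ∀ n → modPow2 n i < 2 ^ i
  modPow2<2^ n = m%n<n n (2 ^ i)

  digits : ∀ n → ∃[ r ] ∃[ q ] r < 2 ^ i × n ≡ r + q * 2 ^ i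
  digits n = modPow2 n i , divPow2 n i , modPow2<2^ n , m≡m%n+[m/n]*n n (2 ^ i)

  digits-unique : ∀ {n q r} → r < 2 ^ i → n ≡ r + q * 2 ^ i →
                  modPow2 n i ≡ r × divPow2 n i ≡ q
  digits-unique {q = q} {r} r<2^i refl =
      trans ([m+kn]%n≡m%n r q (2 ^ i)) (m<n⇒m%n≡m r<2^i)
    , trans (+-distrib-/-∣ʳ r (n∣m*n q)) (cong₂ _+_ (m<n⇒m/n≡0 r<2^i) (m*n/n≡m q (2 ^ i)))

lamᵈ : ℕ → ℕ → ℕ → ℕ
lamᵈ zero    r _ = r
lamᵈ (suc _) r N = N ∸ r

lam≡lamᵈ : ∀ n i → lam n i ≡ lamᵈ (bit n i) (modPow2 n i) (2 ^ i)
lam≡lamᵈ n i with bit n i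
... | zero  = refl
... | suc _ = refl

lam-digits : ∀ i q {n r} → r < 2 ^ i → n ≡ r + q * 2 ^ i → lam n i ≡ lamᵈ (q % 2) r (2 ^ i)
lam-digits i q {n} r<2^i n≡ with digits-unique i {q = q} r<2^i n≡
... | mod≡r , div≡q = trans (lam≡lamᵈ n i) (cong₂ (λ d ρ → lamᵈ (d % 2) ρ (2 ^ i)) div≡q mod≡r)

lamᵈ-double : ∀ β {r N} → r ≤ N → lamᵈ β (r + r) (2 * N) ≡ lamᵈ β r N + lamᵈ β r N
lamᵈ-double zero    _   = refl
lamᵈ-double (suc _) {r} r≤N with k , refl ← m≤n⇒∃[o]m+o≡n r≤N = begin
  2 * (r + k) ∸ (r + r)         ≡⟨ cong (_∸ (r + r)) (shape r k) ⟩
  (r + r) + (k + k) ∸ (r + r)   ≡⟨ m+n∸m≡n (r + r) (k + k) ⟩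
  k + k                         ≡⟨ cong₂ _+_ (m+n∸m≡n r k) (m+n∸m≡n r k) ⟨
  (r + k ∸ r) + (r + k ∸ r)     ∎
  where
  shape : ∀ r k → 2 * (r + k) ≡ (r + r) + (k + k)
  shape = solve-∀

lamᵈ-double+1 : ∀ β {r N} → r < N → lamᵈ β (suc (r + r)) (2 * N) ≡ lamᵈ β r N + lamᵈ β (suc r) N
lamᵈ-double+1 zero    {r} _   = sym (+-suc r r)
lamᵈ-double+1 (suc _) {r} r<N with k , refl ← m≤n⇒∃[o]m+o≡n r<N = begin
  2 * (suc r + k) ∸ suc (r + r)               ≡⟨ cong (_∸ suc (r + r)) (shape r k) ⟩
  suc (r + r) + suc (k + k) ∸ suc (r + r)     ≡⟨ m+n∸m≡n (suc (r + r)) (suc (k + k)) ⟩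
  suc k + k                                   ≡⟨ cong₂ _+_ (trans (cong (_∸ r) (sym (+-suc r k))) (m+n∸m≡n r (suc k))) (m+n∸m≡n r k) ⟨
  (suc r + k ∸ r) + (suc r + k ∸ suc r)       ∎
  where
  shape : ∀ r k → 2 * (suc r + k) ≡ suc (r + r) + suc (k + k)
  shape = solve-∀

-- If a = r + q N with r + 1 = N, then a + 1 = 0 + (q + 1) N: incrementing a clears its
-- residue and flips its digit.
lamᵈ-carry : ∀ q {r N} → suc r ≡ N →
             lamᵈ (q % 2) (suc (r + r)) (2 * N) ≡ lamᵈ (q % 2) r N + lamᵈ (suc q % 2) 0 N
lamᵈ-carry zero          {r} refl = sym (+-suc r r)
lamᵈ-carry (suc zero)    {r} refl = begin
  2 * suc r ∸ suc (r + r)         ≡⟨ cong (_∸ suc (r + r)) (shape r) ⟩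
  suc (r + r) + 1 ∸ suc (r + r)   ≡⟨ m+n∸m≡n (suc (r + r)) 1 ⟩
  1                               ≡⟨ trans (+-identityʳ _) (m+n∸n≡m 1 r) ⟨
  (suc r ∸ r) + 0                 ∎
  where
  shape : ∀ r → 2 * suc r ≡ suc (r + r) + 1
  shape = solve-∀
lamᵈ-carry (suc (suc q)) r+1≡N = lamᵈ-carry q r+1≡N

lamᵈ-parity : ∀ q → lamᵈ (q % 2) 0 1 ≡ q % 2
lamᵈ-parity zero          = refl
lamᵈ-parity (suc zero)    = refl
lamᵈ-parity (suc (suc q)) = lamᵈ-parity q

lam-zero : ∀ n → lam n 0 ≡ n % 2
lam-zero n = trans (lam-digits 0 n z<s (sym (*-identityʳ n))) (lamᵈ-parity n)

[n+n]%2≡0 : ∀ n → (n + n) % 2 ≡ 0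
[n+n]%2≡0 zero    = refl
[n+n]%2≡0 (suc n) = trans (cong (λ m → suc m % 2) (+-suc n n)) ([n+n]%2≡0 n)

[n+1+n]%2≡1 : ∀ n → (n + suc n) % 2 ≡ 1
[n+1+n]%2≡1 zero    = refl
[n+1+n]%2≡1 (suc n) = trans (cong (λ m → suc m % 2) (+-suc n (suc n))) ([n+1+n]%2≡1 n)

r+r<2*N : ∀ {r N} → r < N → r + r < 2 * N
r+r<2*N {r} {N} r<N = subst (r + r <_) (sym (2*n≡n+n N)) (+-mono-< r<N r<N)

1+r+r<2*N : ∀ {r N} → r < N → suc (r + r) < 2 * N
1+r+r<2*N {r} {N} r<N = subst₂ _<_ (+-suc r r) (sym (2*n≡n+n N)) (+-mono-<-≤ r<N r<N)

lam-even : ∀ a i → lam (a + a) (suc i) ≡ lam a i + lam a i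
lam-even a i with r , q , r<N , refl ← digits i a = begin
  lam (a′ + a′) (suc i)                      ≡⟨ lam-digits (suc i) q (r+r<2*N r<N) (shape r q (2 ^ i)) ⟩
  lamᵈ (q % 2) (r + r) (2 * 2 ^ i)           ≡⟨ lamᵈ-double (q % 2) (<⇒≤ r<N) ⟩
  lamᵈ (q % 2) r (2 ^ i) + lamᵈ (q % 2) r (2 ^ i) ≡⟨ cong₂ _+_ a′-digits a′-digits ⟨
  lam a′ i + lam a′ i                        ∎
  where
  a′ : ℕ
  a′ = r + q * 2 ^ i
  a′-digits : lam a′ i ≡ lamᵈ (q % 2) r (2 ^ i)
  a′-digits = lam-digits i q r<N refl
  shape : ∀ r q N → (r + q * N) + (r + q * N) ≡ (r + r) + q * (2 * N)
  shape = solve-∀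

lam-odd : ∀ a i → lam (a + suc a) (suc i) ≡ lam a i + lam (suc a) i
lam-odd a i with r , q , r<N , refl ← digits i a =
  trans (lam-digits (suc i) q (1+r+r<2*N r<N) (shape r q (2 ^ i))) (by-carry (m≤n⇒m<n∨m≡n r<N))
  where
  a′-digits : lam (r + q * 2 ^ i) i ≡ lamᵈ (q % 2) r (2 ^ i)
  a′-digits = lam-digits i q r<N refl
  by-carry : suc r < 2 ^ i ⊎ suc r ≡ 2 ^ i →
             lamᵈ (q % 2) (suc (r + r)) (2 * 2 ^ i) ≡ lam (r + q * 2 ^ i) i + lam (suc r + q * 2 ^ i) i
  by-carry (inj₁ r+1<N) = trans (lamᵈ-double+1 (q % 2) r<N)
    (sym (cong₂ _+_ a′-digits (lam-digits i q r+1<N refl)))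
  by-carry (inj₂ r+1≡N) = trans (lamᵈ-carry q r+1≡N)
    (sym (cong₂ _+_ a′-digits (lam-digits i (suc q) (m^n>0 2 i) (cong (_+ q * 2 ^ i) r+1≡N))))
  shape : ∀ r q N → (r + q * N) + suc (r + q * N) ≡ suc (r + r) + q * (2 * N)
  shape = solve-∀

sumBelow-shift : ∀ m f → sumBelow (suc m) f ≡ f 0 + sumBelow m (λ i → f (suc i))
sumBelow-shift zero    f = +-comm 0 (f 0)
sumBelow-shift (suc m) f = trans (cong (_+ f (suc m)) (sumBelow-shift m f)) (+-assoc (f 0) _ _)

sumBelow-cong : ∀ m {f g} → (∀ i → f i ≡ g i) → sumBelow m f ≡ sumBelow m g
sumBelow-cong zero    f≡g = refl
sumBelow-cong (suc m) f≡g = cong₂ _+_ (sumBelow-cong m f≡g) (f≡g m)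

sumBelow-+ : ∀ m f g → sumBelow m (λ i → f i + g i) ≡ sumBelow m f + sumBelow m g
sumBelow-+ zero    f g = refl
sumBelow-+ (suc m) f g =
  trans (cong (_+ (f m + g m)) (sumBelow-+ m f g)) (interchange (sumBelow m f) (sumBelow m g) (f m) (g m))

sumBelowℤ≡+sumBelow : ∀ m {f g} → (∀ i → f i ≡ + g i) → sumBelowℤ m f ≡ + sumBelow m g
sumBelowℤ≡+sumBelow zero    f≡g = refl
sumBelowℤ≡+sumBelow (suc m) f≡g = cong₂ ℤ._+_ (sumBelowℤ≡+sumBelow m f≡g) (f≡g m)

Λ : ℕ → ℕ → ℕ
Λ m n = sumBelow m (lam n)

Λ-even : ∀ m a → Λ (suc m) (a + a) ≡ Λ m a + Λ m a
Λ-even m a = begin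
  Λ (suc m) (a + a)                                        ≡⟨ sumBelow-shift m (lam (a + a)) ⟩
  lam (a + a) 0 + sumBelow m (λ i → lam (a + a) (suc i))
    ≡⟨ cong₂ _+_ (trans (lam-zero (a + a)) ([n+n]%2≡0 a)) (sumBelow-cong m (lam-even a)) ⟩
  sumBelow m (λ i → lam a i + lam a i)                     ≡⟨ sumBelow-+ m (lam a) (lam a) ⟩
  Λ m a + Λ m a                                            ∎

Λ-odd : ∀ m a → Λ (suc m) (a + suc a) ≡ suc (Λ m a + Λ m (suc a))
Λ-odd m a = begin
  Λ (suc m) (a + suc a)                                            ≡⟨ sumBelow-shift m (lam (a + suc a)) ⟩
  lam (a + suc a) 0 + sumBelow m (λ i → lam (a + suc a) (suc i))
    ≡⟨ cong₂ _+_ (trans (lam-zero (a + suc a)) ([n+1+n]%2≡1 a)) (sumBelow-cong m (lam-odd a)) ⟩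
  suc (sumBelow m (λ i → lam a i + lam (suc a) i))                 ≡⟨ cong suc (sumBelow-+ m (lam a) (lam (suc a))) ⟩
  suc (Λ m a + Λ m (suc a))                                        ∎

explicit-digit : ∀ {β r} N → β < 2 → r < N → + (β * N) ℤ.+ negOnePow β ℤ.* + r ≡ + lamᵈ β r N
explicit-digit {zero}        {r} _ _ _   = trans (ℤ.+-identityˡ _) (ℤ.*-identityˡ (+ r))
explicit-digit {suc zero}    {r} N _ r<N = begin
  + (N + 0) ℤ.+ ℤ.- + 1 ℤ.* + r   ≡⟨ cong₂ ℤ._+_ (cong +_ (+-identityʳ N)) (ℤ.-1*i≡-i (+ r)) ⟩
  + N ℤ.- + r                     ≡⟨ ℤ.m-n≡m⊖n N r ⟩
  N ℤ.⊖ r                         ≡⟨ ℤ.⊖-≥ (<⇒≤ r<N) ⟩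
  + (N ∸ r)                       ∎
explicit-digit {suc (suc _)} _ (s≤s (s≤s ())) _

explicitTerm≡lam : ∀ n i → explicitTerm n i ≡ + lam n i
explicitTerm≡lam n i =
  trans (explicit-digit (2 ^ i) (m%n<n (divPow2 n i) 2) (modPow2<2^ i n))
        (cong +_ (sym (lam≡lamᵈ n i)))

DyadicRange : ℕ → ℕ → Set
DyadicRange m n = 2 ^ m ≤ n × n ≤ 2 ^ suc m

dyadic-half : ∀ {m a} → DyadicRange (suc m) (a + a) → DyadicRange m a
dyadic-half {m} {a} (lo , hi) =
    m+m≤n+n⇒m≤n (subst (_≤ a + a) (2*n≡n+n (2 ^ m)) lo)
  , m+m≤n+n⇒m≤n (subst (a + a ≤_) (2*n≡n+n (2 ^ suc m)) hi)

dyadic-half-odd : ∀ {m a} → DyadicRange (suc m) (a + suc a) → DyadicRange m a × DyadicRange m (suc a)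
dyadic-half-odd {m} {a} (lo , hi) =
  (2^m≤a , ≤-trans (n≤1+n a) a<2^[1+m]) , (≤-trans 2^m≤a (n≤1+n a) , a<2^[1+m])
  where
  2^m≤a : 2 ^ m ≤ a
  2^m≤a = m+m≤n+1+n⇒m≤n (subst (_≤ a + suc a) (2*n≡n+n (2 ^ m)) lo)
  a<2^[1+m] : a < 2 ^ suc m
  a<2^[1+m] = n+1+n≤m+m⇒n<m (subst (a + suc a ≤_) (2*n≡n+n (2 ^ suc m)) hi)

n≤2^[1+⌊log₂n⌋] : ∀ n → n ≤ 2 ^ suc ⌊log₂ n ⌋
n≤2^[1+⌊log₂n⌋] n = ≮⇒≥ λ 2^[1+⌊log₂n⌋]<n →
  1+n≰n (subst (_≤ ⌊log₂ n ⌋) (⌊log₂[2^n]⌋≡n (suc ⌊log₂ n ⌋)) (⌊log₂⌋-mono-≤ (<⇒≤ 2^[1+⌊log₂n⌋]<n)))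

⌊n/2⌋+⌊n/2⌋≤n : ∀ n → ⌊ n /2⌋ + ⌊ n /2⌋ ≤ n
⌊n/2⌋+⌊n/2⌋≤n n = subst (⌊ n /2⌋ + ⌊ n /2⌋ ≤_) (⌊n/2⌋+⌈n/2⌉≡n n) (+-monoʳ-≤ ⌊ n /2⌋ (⌊n/2⌋≤⌈n/2⌉ n))

2^⌊log₂n⌋≤n : ∀ {L} n → 1 ≤ n → ⌊log₂ n ⌋ ≡ L → 2 ^ L ≤ n
2^⌊log₂n⌋≤n {zero}  n             1≤n _     = 1≤n
2^⌊log₂n⌋≤n {suc L} (suc zero)    _   ()
2^⌊log₂n⌋≤n {suc L} (suc (suc k)) _   log≡L =
  ≤-trans (≤-reflexive (2*n≡n+n (2 ^ L))) (≤-trans (+-mono-≤ 2^L≤n/2 2^L≤n/2) (⌊n/2⌋+⌊n/2⌋≤n (suc (suc k))))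
  where
  2^L≤n/2 : 2 ^ L ≤ suc ⌊ k /2⌋
  2^L≤n/2 = 2^⌊log₂n⌋≤n {L} (suc ⌊ k /2⌋) (s≤s z≤n)
    (trans (⌊log₂⌊n/2⌋⌋≡⌊log₂n⌋∸1 (suc (suc k))) (cong (_∸ 1) log≡L))

⌊log₂n⌋-dyadic : ∀ n → 1 ≤ n → DyadicRange ⌊log₂ n ⌋ n
⌊log₂n⌋-dyadic n 1≤n = 2^⌊log₂n⌋≤n n 1≤n refl , n≤2^[1+⌊log₂n⌋] n

data Balanced : ℕ → ℕ → Set where
  even  : ∀ a → Balanced a a
  oddʳ  : ∀ a → Balanced a (suc a)
  oddˡ  : ∀ a → Balanced (suc a) a

balanced : ∀ {a b} → DiffAtMostOne a b → Balanced a b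
balanced {zero}        {zero}        _               = even 0
balanced {zero}        {suc zero}    _               = oddʳ 0
balanced {zero}        {suc (suc _)} (_ , s≤s ())
balanced {suc zero}    {zero}        _               = oddˡ 0
balanced {suc (suc _)} {zero}        (s≤s () , _)
balanced {suc a}       {suc b}       (a≤b+1 , b≤a+1) with balanced {a} {b} (≤-pred a≤b+1 , ≤-pred b≤a+1)
... | even _ = even (suc a)
... | oddʳ _ = oddʳ (suc a)
... | oddˡ _ = oddˡ (suc b)

-- Quantifying over every admissible m, not just ⌊log₂ n⌋, lets the halves a and a + 1 of an
-- odd number share the same m even when a + 1 is a power of two.
MatchesΛ : ℕ → ℕ → Set
MatchesΛ n d = ∀ m → DyadicRange m n → d ≡ Λ m n

matchesΛ-even : ∀ {a x y} → 1 ≤ a → MatchesΛ a x → MatchesΛ a y → MatchesΛ (a + a) (x + y)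
matchesΛ-even {a} 1≤a x≡ y≡ zero    (_ , a+a≤2) = cong₂ _+_ (x≡ 0 range) (y≡ 0 range)
  where
  range : DyadicRange 0 a
  range = 1≤a , ≤-trans (m≤m+n a a) a+a≤2
matchesΛ-even {a} _   x≡ y≡ (suc m) range =
  trans (cong₂ _+_ (x≡ m (dyadic-half {m} range)) (y≡ m (dyadic-half {m} range))) (sym (Λ-even m a))

matchesΛ-odd : ∀ {a x y} → 1 ≤ a → MatchesΛ a x → MatchesΛ (suc a) y → MatchesΛ (a + suc a) (suc (x + y))
matchesΛ-odd {a} 1≤a _  _  zero    (_ , a+1+a≤2) =
  contradiction a+1+a≤2 (<⇒≱ (+-mono-≤ 1≤a (s≤s 1≤a)))
matchesΛ-odd {a} _   x≡ y≡ (suc m) range with dyadic-half-odd {m} range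
... | range-a , range-1+a = trans (cong suc (cong₂ _+_ (x≡ m range-a) (y≡ m range-1+a))) (sym (Λ-odd m a))

joinD : ∀ {a b : ℕ} → Dec (a ≡ b) → ℕ → ℕ → ℕ
joinD (yes _) x y = x + y
joinD (no _)  x y = suc (x + y)

matchesΛ-join : ∀ {a b x y} (a≟b : Dec (a ≡ b)) → Balanced a b → 1 ≤ a → 1 ≤ b →
                MatchesΛ a x → MatchesΛ b y → MatchesΛ (a + b) (joinD a≟b x y)
matchesΛ-join (yes _)   (even a) 1≤a _   x≡ y≡ = matchesΛ-even 1≤a x≡ y≡
matchesΛ-join (no a≢a)  (even a) _   _   _  _  = contradiction refl a≢a
matchesΛ-join (yes a≡b) (oddʳ a) _   _   _  _  = contradiction (sym a≡b) 1+n≢n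
matchesΛ-join (no _)    (oddʳ a) 1≤a _   x≡ y≡ = matchesΛ-odd 1≤a x≡ y≡
matchesΛ-join (yes a≡b) (oddˡ a) _   _   _  _  = contradiction a≡b 1+n≢n
matchesΛ-join {x = x} {y} (no _) (oddˡ a) _ 1≤b x≡ y≡ =
  subst₂ MatchesΛ (+-comm a (suc a)) (cong suc (+-comm y x)) (matchesΛ-odd 1≤b y≡ x≡)

dnodes-node : ∀ l r → dnodes (node l r) ≡ joinD (leaves l ≟ leaves r) (dnodes l) (dnodes r)
dnodes-node l r with leaves l ≟ leaves r
... | yes _ = refl
... | no _  = refl

1≤leaves : ∀ t → 1 ≤ leaves t
1≤leaves leaf       = ≤-refl
1≤leaves (node l r) = ≤-trans (1≤leaves l) (m≤m+n (leaves l) (leaves r))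

dnodes-matchesΛ : ∀ t → IsDC t → MatchesΛ (leaves t) (dnodes t)
dnodes-matchesΛ leaf _ zero    _               = refl
dnodes-matchesΛ leaf _ (suc m) (2^[1+m]≤1 , _) =
  contradiction 2^[1+m]≤1 (<⇒≱ (^-monoʳ-< 2 (s≤s (s≤s z≤n)) (z<s {m})))
dnodes-matchesΛ (node l r) (l~r , dc-l , dc-r) m range =
  trans (dnodes-node l r)
    (matchesΛ-join (leaves l ≟ leaves r) (balanced l~r) (1≤leaves l) (1≤leaves r)
      (dnodes-matchesΛ l dc-l) (dnodes-matchesΛ r dc-r) m range)

theorem57 : (n : ℕ) → 1 ≤ n → (t : Tree) → IsDC t → leaves t ≡ n →
    (dnodes t ≡ sumBelow ⌊log₂ n ⌋ (lam n))
    × (+ dnodes t ≡ sumBelowℤ ⌊log₂ n ⌋ (explicitTerm n))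
theorem57 n 1≤n t dc refl =
  δ≡Λ , trans (cong +_ δ≡Λ) (sym (sumBelowℤ≡+sumBelow ⌊log₂ n ⌋ (explicitTerm≡lam n)))
  where
  δ≡Λ : dnodes t ≡ Λ ⌊log₂ n ⌋ n
  δ≡Λ = dnodes-matchesΛ t dc ⌊log₂ n ⌋ (⌊log₂n⌋-dyadic n 1≤n)
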